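{- Let $H$ be a connected hypergraph and let $n\in\mathbb{N}$ with $n\geq 2$. Then $b_{L,\frac{1}{n}}(H)\leq \left\lceil\frac{|V(H)|}{n}\right\rceil$.
   Context: A hypergraph $H=(V(H),E(H))$ has a finite nonempty vertex set and a finite collection $E(H)$ of subsets of $V(H)$ called edges (parallel edges allowed); two vertices are adjacent if they lie in a common edge, and $H$ is connected if any two vertices are joined by a path of adjacent vertices. For a proportion $p\in(0,1)$, the proportion-based propagation rule is: if at some time step at least $\lceil p|e|\rceil$ vertices of an edge $e$ are on fire, then in the next time step all vertices of $e$ catch fire; burned vertices stay burned. A set $S\subseteq V(H)$ is a lazy burning set if, setting all of $S$ on fire at once and then repeatedly applying the propagation rule, every vertex eventually catches fire; $b_{L,p}(H)$ is the minimum size of a lazy burning set. -}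

module Defs where

open import Data.Nat using (ℕ; zero; suc)
open import Data.Fin using (Fin)
open import Data.Fin.Subset using (Subset; _∈_; _∩_; _∪_; ⊤; ∣_∣)
open import Data.List using (List; []; _∷_; foldr)
open import Data.List.Membership.Propositional renaming (_∈_ to _∈ₗ_)
open import Data.Product using (Σ; ∃; _×_; _,_)
open import Data.Integer as ℤ using (ℤ; +_)
open import Data.Rational using (ℚ; _*_; _/_; ceiling)
open import Relation.Nullary using (yes; no)
open import Relation.Binary.PropositionalEquality using (_≡_)
open import Relation.Binary.Construct.Closure.ReflexiveTransitive using (Star)

-- A hypergraph on the vertex set Fin (suc k) (finite, nonempty), with a
-- finite list of edges (parallel edges allowed), each edge a subset.
record Hypergraph : Set where
  constructor hypergraph
  field
    k     : ℕ
    edges : List (Subset (suc k))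

open Hypergraph public

order : Hypergraph → ℕ
order H = suc (k H)

V : Hypergraph → Set
V H = Fin (order H)

Adjacent : (H : Hypergraph) → V H → V H → Set
Adjacent H x y = Σ (Subset (order H)) λ e → e ∈ₗ edges H × (x ∈ e × y ∈ e)

Connected : Hypergraph → Set
Connected H = (x y : V H) → Star (Adjacent H) x y

threshold : ℚ → ℕ → ℤ
threshold p m = ⌈ p * (+ m / 1) ⌉

step : (p : ℚ) {n : ℕ} → List (Subset n) → Subset n → Subset n
step p es S = foldr add S es
  where
  add : _ → _ → _
  add e acc with threshold p ∣ e ∣ ℤ.≤? + ∣ S ∩ e ∣
  ... | yes _ = acc ∪ e
  ... | no  _ = acc

iterate : {A : Set} → (A → A) → ℕ → A → A
iterate f zero    a = a
iterate f (suc t) a = f (iterate f t a)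

burnedAfter : (p : ℚ) (H : Hypergraph) → ℕ → Subset (order H) → Subset (order H)
burnedAfter p H t S = iterate (step p (edges H)) t S

IsLazyBurningSet : (p : ℚ) (H : Hypergraph) → Subset (order H) → Set
IsLazyBurningSet p H S = ∃ λ t → burnedAfter p H t S ≡ ⊤

-- b_{L,p}(H) ≤ c  (the minimum size of a lazy burning set is at most c)
LazyBurningNumber≤ : (p : ℚ) (H : Hypergraph) → ℤ → Set
LazyBurningNumber≤ p H c =
  Σ (Subset (order H)) λ S → IsLazyBurningSet p H S × (+ ∣ S ∣ ℤ.≤ c)

module Submission where

-- Grow a seed set S from a single vertex, keeping n·|S| < |C| + n for the set C that S
-- eventually burns. While C ≠ V, connectivity gives an edge e meeting both C and V ∖ C,
-- say in c ≥ 1 burning vertices. Seeding ⌈|e|/n⌉ − c more vertices of e ∖ C ignites e,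
-- and because c ≥ 1 these seeds number at most |e ∖ C|/n, while C grows by |e ∖ C|.
-- Once C = V the invariant reads |S| ≤ ⌈|V|/n⌉.

open import Defs
open import Data.Nat using (ℕ; zero; suc; NonZero; _≤_; _<_; _+_; _*_; _∸_; z≤n; s≤s; s≤s⁻¹)
open import Data.Nat.Properties
open import Data.Nat.Tactic.RingSolver using (solve-∀)
open import Data.Integer as ℤ using (ℤ; +_; -[1+_]; -_)
import Data.Integer.Properties as ℤ
import Data.Integer.DivMod as ℤ
import Data.Integer.Tactic.RingSolver as ℤ
open import Data.Rational using (ℚ; ↥_; ↧_; _/_; ceiling; floor)
import Data.Rational as ℚ
import Data.Rational.Properties as ℚ
import Data.Rational.Unnormalised as ℚᵘ
import Data.Rational.Unnormalised.Properties as ℚᵘ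
open import Data.Fin using (Fin; zero; suc)
open import Data.Fin.Subset
open import Data.Fin.Subset.Properties
open import Data.Vec.Base using ([]; _∷_; here; there)
open import Data.List using (List; []; _∷_)
open import Data.List.Membership.Propositional using () renaming (_∈_ to _∈ₗ_)
import Data.List.Relation.Unary.Any as Any
open import Data.Product using (Σ-syntax; ∃-syntax; ∃₂; _×_; _,_; proj₁)
open import Data.Sum using (_⊎_; inj₁; inj₂; [_,_])
open import Function using (_∘_)
open import Relation.Nullary using (¬_; yes; no; contradiction)
open import Relation.Unary using (Pred; Decidable)
open import Relation.Binary.PropositionalEquality
  using (_≡_; refl; cong; sym; trans; subst; subst₂; module ≡-Reasoning)
open import Relation.Binary.Construct.Closure.ReflexiveTransitive using (Star; ε; _◅_)

private
  variable
    n : ℕ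
    x : Fin n
    p q r : Subset n

floor-division : ∀ q → ∃[ r ] + r ℤ.< ↧ q × ↥ q ≡ + r ℤ.+ floor q ℤ.* ↧ q
floor-division q@record{} = ↥ q ℤ.% ↧ q , ℤ.+<+ (ℤ.n%d<d (↥ q) (↧ q)) , ℤ.a≡a%n+[a/n]*n (↥ q) (↧ q)

ceiling-division : ∀ q → ∃[ r ] + r ℤ.< ↧ q × ⌈ q ⌉ ℤ.* ↧ q ≡ + r ℤ.+ ↥ q
ceiling-division q@record{} with floor-division (ℚ.- q)
... | r , r<↧-q , ↥-q≡r+f↧-q = r , subst (+ r ℤ.<_) (ℚ.↧-neg q) r<↧-q , (begin
  - f ℤ.* ↧ q                           ≡⟨ cong (- f ℤ.*_) (sym (ℚ.↧-neg q)) ⟩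
  - f ℤ.* ↧ (ℚ.- q)                     ≡⟨ negate (+ r) f (↧ (ℚ.- q)) ⟩
  + r ℤ.+ - (+ r ℤ.+ f ℤ.* ↧ (ℚ.- q))   ≡⟨ cong (λ i → + r ℤ.+ - i) (sym ↥-q≡r+f↧-q) ⟩
  + r ℤ.+ - ↥ (ℚ.- q)                   ≡⟨ cong (λ i → + r ℤ.+ - i) (ℚ.↥-neg q) ⟩
  + r ℤ.+ - (- ↥ q)                     ≡⟨ cong (λ i → + r ℤ.+ i) (ℤ.neg-involutive (↥ q)) ⟩
  + r ℤ.+ ↥ q                           ∎)
  where
  open ≡-Reasoning
  f : ℤ
  f = floor (ℚ.- q)
  negate : ∀ r f b → - f ℤ.* b ≡ r ℤ.+ - (r ℤ.+ f ℤ.* b)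
  negate = ℤ.solve-∀

ceiling-bounds : ∀ q m n .{{_ : NonZero n}} → ↥ q ℤ.* + n ≡ + m ℤ.* ↧ q →
  + m ℤ.≤ ⌈ q ⌉ ℤ.* + n × ⌈ q ⌉ ℤ.* + n ℤ.< + m ℤ.+ + n
ceiling-bounds q@record{} m n@(suc _) cross with ceiling-division q
... | r , r<↧q , ⌈q⌉↧q≡r+↥q =
  ℤ.*-cancelʳ-≤-pos (+ m) (c ℤ.* + n) (↧ q)
    (subst (+ m ℤ.* ↧ q ℤ.≤_) (sym scaled)
      (subst (λ i → + m ℤ.* ↧ q ℤ.≤ i ℤ.+ + m ℤ.* ↧ q) (ℤ.pos-* r n) (ℤ.i≤j+i _ (+ (r * n))))) ,
  ℤ.*-cancelʳ-<-nonNeg (↧ q)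
    (subst₂ ℤ._<_ (sym scaled) (regroup (+ m) (+ n) (↧ q))
      (ℤ.+-monoˡ-< (+ m ℤ.* ↧ q) (ℤ.*-monoʳ-<-pos (+ n) r<↧q)))
  where
  open ≡-Reasoning
  c : ℤ
  c = ⌈ q ⌉
  swap : ∀ x y z → x ℤ.* y ℤ.* z ≡ x ℤ.* z ℤ.* y
  swap = ℤ.solve-∀
  regroup : ∀ x y z → z ℤ.* y ℤ.+ x ℤ.* z ≡ (x ℤ.+ y) ℤ.* z
  regroup = ℤ.solve-∀
  scaled : c ℤ.* + n ℤ.* ↧ q ≡ + r ℤ.* + n ℤ.+ + m ℤ.* ↧ q
  scaled = begin
    c ℤ.* + n ℤ.* ↧ q            ≡⟨ swap c (+ n) (↧ q) ⟩
    (c ℤ.* ↧ q) ℤ.* + n          ≡⟨ cong (ℤ._* + n) ⌈q⌉↧q≡r+↥q ⟩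
    (+ r ℤ.+ ↥ q) ℤ.* + n        ≡⟨ ℤ.*-distribʳ-+ (+ n) (+ r) (↥ q) ⟩
    + r ℤ.* + n ℤ.+ ↥ q ℤ.* + n  ≡⟨ cong (λ i → + r ℤ.* + n ℤ.+ i) cross ⟩
    + r ℤ.* + n ℤ.+ + m ℤ.* ↧ q  ∎

↥[m/n]*n≡m*↧[m/n] : ∀ m n .{{_ : NonZero n}} → ↥ (+ m / n) ℤ.* + n ≡ + m ℤ.* ↧ (+ m / n)
↥[m/n]*n≡m*↧[m/n] m n@(suc n-1) = subst₂ (λ a b → a ℤ.* + n ≡ + m ℤ.* b)
  (ℚ.↥ᵘ-toℚᵘ (+ m / n)) (ℚ.↧ᵘ-toℚᵘ (+ m / n))
  (ℚᵘ.drop-*≡* (ℚ.toℚᵘ-fromℚᵘ (ℚᵘ.mkℚᵘ (+ m) n-1)))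

-- Compared in ℚᵘ, where neither the product nor the fractions are normalised by gcds.
1/n*m≡m/n : ∀ m n .{{_ : NonZero n}} → (+ 1 / n) ℚ.* (+ m / 1) ≡ + m / n
1/n*m≡m/n m n@(suc n-1) = ℚ.toℚᵘ-injective (begin
  ℚ.toℚᵘ ((+ 1 / n) ℚ.* (+ m / 1))        ≈⟨ ℚ.toℚᵘ-homo-* (+ 1 / n) (+ m / 1) ⟩
  ℚ.toℚᵘ (+ 1 / n) ℚᵘ.* ℚ.toℚᵘ (+ m / 1)  ≈⟨ ℚᵘ.*-cong (ℚ.toℚᵘ-fromℚᵘ (ℚᵘ.mkℚᵘ (+ 1) n-1))
                                                       (ℚ.toℚᵘ-fromℚᵘ (ℚᵘ.mkℚᵘ (+ m) 0)) ⟩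
  ℚᵘ.mkℚᵘ (+ 1) n-1 ℚᵘ.* ℚᵘ.mkℚᵘ (+ m) 0  ≈⟨ ℚᵘ.*≡* (unit (+ m) (+ n)) ⟩
  ℚᵘ.mkℚᵘ (+ m) n-1                       ≈⟨ ℚᵘ.≃-sym (ℚ.toℚᵘ-fromℚᵘ (ℚᵘ.mkℚᵘ (+ m) n-1)) ⟩
  ℚ.toℚᵘ (+ m / n)                        ∎)
  where
  open ℚᵘ.≃-Reasoning
  unit : ∀ x y → + 1 ℤ.* x ℤ.* y ≡ x ℤ.* (y ℤ.* + 1)
  unit = ℤ.solve-∀

ceiling-/ : ∀ m n .{{_ : NonZero n}} → ∃[ t ] ⌈ + m / n ⌉ ≡ + t × m ≤ t * n × t * n < m + n
ceiling-/ m n@(suc _) with ⌈ + m / n ⌉ | ceiling-bounds (+ m / n) m n (↥[m/n]*n≡m*↧[m/n] m n)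
... | + t      | lower , upper =
  t , refl ,
  ℤ.drop‿+≤+ (subst (+ m ℤ.≤_) (sym (ℤ.pos-* t n)) lower) ,
  ℤ.drop‿+<+ (subst (ℤ._< + m ℤ.+ + n) (sym (ℤ.pos-* t n)) upper)
... | -[1+ _ ] | () , _

-- Uses c·n ≥ c + n − 1, i.e. (c − 1)(n − 1) ≥ 0.
[c+a]*n<c+d+n⇒n*a≤d : ∀ n a c d .{{_ : NonZero n}} → 0 < c → (c + a) * n < c + d + n → n * a ≤ d
[c+a]*n<c+d+n⇒n*a≤d n@(suc n-1) a (suc c-1) d _ bound =
  ≤-trans (m≤m+n (n * a) (c-1 * n-1))
    (s≤s⁻¹ (+-cancelʳ-< (c-1 + n) (n * a + c-1 * n-1) (suc d)
      (subst₂ _<_ (lhs a c-1 n-1) (rhs d c-1 n-1) bound)))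
  where
  lhs : ∀ a c n → (suc c + a) * suc n ≡ suc n * a + c * n + (c + suc n)
  lhs = solve-∀
  rhs : ∀ d c n → suc c + d + suc n ≡ suc d + (c + suc n)
  rhs = solve-∀

n*[t∸c]≤d : ∀ n t c d .{{_ : NonZero n}} → 0 < c → t * n < c + d + n → n * (t ∸ c) ≤ d
n*[t∸c]≤d n t c d 0<c bound with ≤-total t c
... | inj₁ t≤c = subst (_≤ d) (sym (trans (cong (n *_) (m≤n⇒m∸n≡0 t≤c)) (*-zeroʳ n))) z≤n
... | inj₂ c≤t = [c+a]*n<c+d+n⇒n*a≤d n (t ∸ c) c d 0<c
                   (subst (λ x → x * n < c + d + n) (sym (m+[n∸m]≡n c≤t)) bound)

n*s<m+n⇒s≤t : ∀ n s m t .{{_ : NonZero n}} → n * s < m + n → m ≤ t * n → s ≤ t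
n*s<m+n⇒s≤t n s m t bound m≤t*n = s≤s⁻¹ (*-cancelˡ-< n s (suc t) (begin-strict
  n * s      <⟨ bound ⟩
  m + n      ≤⟨ +-monoˡ-≤ n m≤t*n ⟩
  t * n + n  ≡⟨ +-comm (t * n) n ⟩
  n + t * n  ≡⟨ cong (λ x → n + x) (*-comm t n) ⟩
  n + n * t  ≡⟨ *-suc n t ⟨
  n * suc t  ∎))
  where open ≤-Reasoning

∣p∪q∣≡∣p∣+∣q─p∣ : ∀ (p q : Subset n) → ∣ p ∪ q ∣ ≡ ∣ p ∣ + ∣ q ─ p ∣
∣p∪q∣≡∣p∣+∣q─p∣ []            []            = refl
∣p∪q∣≡∣p∣+∣q─p∣ (inside  ∷ p) (inside  ∷ q) = cong suc (∣p∪q∣≡∣p∣+∣q─p∣ p q)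
∣p∪q∣≡∣p∣+∣q─p∣ (inside  ∷ p) (outside ∷ q) = cong suc (∣p∪q∣≡∣p∣+∣q─p∣ p q)
∣p∪q∣≡∣p∣+∣q─p∣ (outside ∷ p) (inside  ∷ q) =
  trans (cong suc (∣p∪q∣≡∣p∣+∣q─p∣ p q)) (sym (+-suc ∣ p ∣ ∣ q ─ p ∣))
∣p∪q∣≡∣p∣+∣q─p∣ (outside ∷ p) (outside ∷ q) = ∣p∪q∣≡∣p∣+∣q─p∣ p q

∣q∣≡∣p∩q∣+∣q─p∣ : ∀ (p q : Subset n) → ∣ q ∣ ≡ ∣ p ∩ q ∣ + ∣ q ─ p ∣
∣q∣≡∣p∩q∣+∣q─p∣ []            []            = refl
∣q∣≡∣p∩q∣+∣q─p∣ (inside  ∷ p) (inside  ∷ q) = cong suc (∣q∣≡∣p∩q∣+∣q─p∣ p q)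
∣q∣≡∣p∩q∣+∣q─p∣ (inside  ∷ p) (outside ∷ q) = ∣q∣≡∣p∩q∣+∣q─p∣ p q
∣q∣≡∣p∩q∣+∣q─p∣ (outside ∷ p) (inside  ∷ q) =
  trans (cong suc (∣q∣≡∣p∩q∣+∣q─p∣ p q)) (sym (+-suc ∣ p ∩ q ∣ ∣ q ─ p ∣))
∣q∣≡∣p∩q∣+∣q─p∣ (outside ∷ p) (outside ∷ q) = ∣q∣≡∣p∩q∣+∣q─p∣ p q

∣p∪q∣≤∣p∣+∣q∣ : ∀ (p q : Subset n) → ∣ p ∪ q ∣ ≤ ∣ p ∣ + ∣ q ∣
∣p∪q∣≤∣p∣+∣q∣ p q = begin
  ∣ p ∪ q ∣       ≡⟨ ∣p∪q∣≡∣p∣+∣q─p∣ p q ⟩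
  ∣ p ∣ + ∣ q ─ p ∣ ≤⟨ +-monoʳ-≤ ∣ p ∣ (∣p─q∣≤∣p∣ q p) ⟩
  ∣ p ∣ + ∣ q ∣     ∎
  where open ≤-Reasoning

x∈p─q⇒x∉q : ∀ (p q : Subset n) → x ∈ p ─ q → x ∉ q
x∈p─q⇒x∉q (inside  ∷ p) (outside ∷ q) here ()
x∈p─q⇒x∉q (_ ∷ p) (_ ∷ q) (there x∈p─q) (there x∈q) = x∈p─q⇒x∉q p q x∈p─q x∈q

x∈p⇒0<∣p∣ : x ∈ p → 0 < ∣ p ∣
x∈p⇒0<∣p∣ here = s≤s z≤n
x∈p⇒0<∣p∣ {p = s ∷ p} (there x∈p) = <-≤-trans (x∈p⇒0<∣p∣ x∈p) (∣p∣≤∣x∷p∣ s p)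

x∉p⇒∣p∣<n : ∀ {n} {p : Subset n} {x} → x ∉ p → ∣ p ∣ < n
x∉p⇒∣p∣<n {n} {p} {x} x∉p = subst (∣ p ∣ <_) (∣⊤∣≡n n) (p⊂q⇒∣p∣<∣q∣ (⊆⊤ , x , ∈⊤ , x∉p))

p≡⊤⊎∃∉ : ∀ (p : Subset n) → p ≡ ⊤ ⊎ ∃[ x ] x ∉ p
p≡⊤⊎∃∉ []            = inj₁ refl
p≡⊤⊎∃∉ (outside ∷ p) = inj₂ (zero , λ ())
p≡⊤⊎∃∉ (inside  ∷ p) with p≡⊤⊎∃∉ p
... | inj₁ refl        = inj₁ refl
... | inj₂ (x , x∉p)   = inj₂ (suc x , λ { (there x∈p) → x∉p x∈p })

∃⊆-ofSize : ∀ (p : Subset n) {a} → a ≤ ∣ p ∣ → ∃[ q ] q ⊆ p × ∣ q ∣ ≡ a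
∃⊆-ofSize {n} p {zero} _ = ⊥ , ⊥⊆ , ∣⊥∣≡0 n
∃⊆-ofSize (inside ∷ p) {suc a} (s≤s a≤∣p∣) with ∃⊆-ofSize p a≤∣p∣
... | q , q⊆p , ∣q∣≡a = inside ∷ q , s⊆s q⊆p , cong suc ∣q∣≡a
∃⊆-ofSize (outside ∷ p) {suc a} a≤∣p∣ with ∃⊆-ofSize p a≤∣p∣
... | q , q⊆p , ∣q∣≡a = outside ∷ q , s⊆s q⊆p , ∣q∣≡a

∪-lub : p ⊆ r → q ⊆ r → p ∪ q ⊆ r
∪-lub {p = p} {q = q} p⊆r q⊆r x∈p∪q = [ p⊆r , q⊆r ] (x∈p∪q⁻ p q x∈p∪q)

∩-monoˡ-⊆ : ∀ r → p ⊆ q → p ∩ r ⊆ q ∩ r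
∩-monoˡ-⊆ {p = p} r p⊆q x∈p∩r with x∈p∩q⁻ p r x∈p∩r
... | x∈p , x∈r = x∈p∩q⁺ (p⊆q x∈p , x∈r)

igniting-seeds : ∀ {m} n t (C e : Subset m) .{{_ : NonZero n}} → 0 < ∣ C ∩ e ∣ → t * n < ∣ e ∣ + n →
  ∃[ A ] A ⊆ e ─ C × n * ∣ A ∣ ≤ ∣ e ─ C ∣ × t ≤ ∣ C ∩ e ∣ + ∣ A ∣
igniting-seeds n t C e 0<c t*n<∣e∣+n =
  let A , A⊆e─C , ∣A∣≡t∸c = ∃⊆-ofSize (e ─ C) (≤-trans (m≤n*m (t ∸ c) n) n*[t∸c]≤∣e─C∣)
  in A , A⊆e─C , subst (λ a → n * a ≤ ∣ e ─ C ∣) (sym ∣A∣≡t∸c) n*[t∸c]≤∣e─C∣ ,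
     subst (λ a → t ≤ c + a) (sym ∣A∣≡t∸c) (m≤n+m∸n t c)
  where
  c : ℕ
  c = ∣ C ∩ e ∣
  n*[t∸c]≤∣e─C∣ : n * (t ∸ c) ≤ ∣ e ─ C ∣
  n*[t∸c]≤∣e─C∣ = n*[t∸c]≤d n t c ∣ e ─ C ∣ 0<c
    (subst (λ k → t * n < k + n) (∣q∣≡∣p∩q∣+∣q─p∣ C e) t*n<∣e∣+n)

star-crossing : ∀ {a ℓ₁ ℓ₂} {A : Set a} {R : A → A → Set ℓ₁} {P : Pred A ℓ₂} → Decidable P →
  ∀ {x y} → Star R x y → P x → ¬ P y → ∃₂ λ u v → R u v × P u × ¬ P v
star-crossing P? ε               Px ¬Py = contradiction Px ¬Py
star-crossing P? (_◅_ {i = x} {j = z} xRz z⋆y) Px ¬Py with P? z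
... | yes Pz = star-crossing P? z⋆y Pz ¬Py
... | no ¬Pz = x , z , xRz , Px , ¬Pz

module _ (p : ℚ) {n : ℕ} where

  step-∷ : ∀ e (es : List (Subset n)) S → step p es S ⊆ step p (e ∷ es) S
  step-∷ e es S with threshold p ∣ e ∣ ℤ.≤? + ∣ S ∩ e ∣
  ... | yes _ = p⊆p∪q e
  ... | no  _ = λ x∈ → x∈

  ⊆-step : ∀ (es : List (Subset n)) S → S ⊆ step p es S
  ⊆-step []       S = λ x∈ → x∈
  ⊆-step (e ∷ es) S = step-∷ e es S ∘ ⊆-step es S

  step-burns : ∀ {es : List (Subset n)} {e} S → e ∈ₗ es →
    threshold p ∣ e ∣ ℤ.≤ + ∣ S ∩ e ∣ → e ⊆ step p es S
  step-burns {e ∷ es} S (Any.here refl) th≤ with threshold p ∣ e ∣ ℤ.≤? + ∣ S ∩ e ∣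
  ... | yes _  = q⊆p∪q (step p es S) e
  ... | no th≰ = contradiction th≤ th≰
  step-burns {f ∷ es} S (Any.there e∈es) th≤ = step-∷ f es S ∘ step-burns S e∈es th≤

  step-mono : ∀ (es : List (Subset n)) {S T} → S ⊆ T → step p es S ⊆ step p es T
  step-mono []       S⊆T = S⊆T
  step-mono (e ∷ es) {S} {T} S⊆T with threshold p ∣ e ∣ ℤ.≤? + ∣ S ∩ e ∣
  ... | no  _      = step-∷ e es T ∘ step-mono es S⊆T
  ... | yes S-hits = ∪-lub {p = step p es S} {q = e}
    (step-∷ e es T ∘ step-mono es S⊆T)
    (step-burns {es = e ∷ es} T (Any.here refl)
      (ℤ.≤-trans S-hits (ℤ.+≤+ (p⊆q⇒∣p∣≤∣q∣ (∩-monoˡ-⊆ e S⊆T)))))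

module _ (p : ℚ) (H : Hypergraph) where

  ⊆-burnedAfter : ∀ t S → S ⊆ burnedAfter p H t S
  ⊆-burnedAfter zero    S x∈S = x∈S
  ⊆-burnedAfter (suc t) S x∈S = ⊆-step p (edges H) _ (⊆-burnedAfter t S x∈S)

  burnedAfter-mono : ∀ t {S T} → S ⊆ T → burnedAfter p H t S ⊆ burnedAfter p H t T
  burnedAfter-mono zero    S⊆T = S⊆T
  burnedAfter-mono (suc t) S⊆T = step-mono p (edges H) (burnedAfter-mono t S⊆T)

  seeding-burns-edge : ∀ t S {A e} → e ∈ₗ edges H → A ⊆ e ─ burnedAfter p H t S →
    threshold p ∣ e ∣ ℤ.≤ + (∣ burnedAfter p H t S ∩ e ∣ + ∣ A ∣) →
    burnedAfter p H t S ∪ e ⊆ burnedAfter p H (suc t) (S ∪ A)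
  seeding-burns-edge t S {A} {e} e∈E A⊆e─C th≤ =
    ∪-lub (⊆-step p (edges H) X ∘ C⊆X)
          (step-burns p X e∈E (ℤ.≤-trans th≤ (ℤ.+≤+ enough)))
    where
    C X : Subset (order H)
    C = burnedAfter p H t S
    X = burnedAfter p H t (S ∪ A)
    C⊆X : C ⊆ X
    C⊆X = burnedAfter-mono t (p⊆p∪q A)
    A⊆X∩e : A ⊆ X ∩ e
    A⊆X∩e x∈A = x∈p∩q⁺ (⊆-burnedAfter t (S ∪ A) (q⊆p∪q S A x∈A) , p─q⊆p e C (A⊆e─C x∈A))
    A⊆A─C∩e : A ⊆ A ─ C ∩ e
    A⊆A─C∩e x∈A = x∈p∧x∉q⇒x∈p─q x∈A (x∈p─q⇒x∉q e C (A⊆e─C x∈A) ∘ proj₁ ∘ x∈p∩q⁻ C e)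
    enough : ∣ C ∩ e ∣ + ∣ A ∣ ≤ ∣ X ∩ e ∣
    enough = begin
      ∣ C ∩ e ∣ + ∣ A ∣               ≤⟨ +-monoʳ-≤ ∣ C ∩ e ∣ (p⊆q⇒∣p∣≤∣q∣ A⊆A─C∩e) ⟩
      ∣ C ∩ e ∣ + ∣ A ─ C ∩ e ∣       ≡⟨ ∣p∪q∣≡∣p∣+∣q─p∣ (C ∩ e) A ⟨
      ∣ C ∩ e ∪ A ∣                   ≤⟨ p⊆q⇒∣p∣≤∣q∣ (∪-lub (∩-monoˡ-⊆ e C⊆X) A⊆X∩e) ⟩
      ∣ X ∩ e ∣                       ∎
      where open ≤-Reasoning

module LazyBurning (p : ℚ) (H : Hypergraph) (connected : Connected H)
  (n : ℕ) .{{_ : NonZero n}}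
  -- t * n < m + n says t ≤ ⌈m/n⌉
  (threshold≤ : ∀ m → ∃[ t ] threshold p m ℤ.≤ + t × t * n < m + n) where

  record Stage : Set where
    field
      seeds      : Subset (order H)
      time       : ℕ
      zero∈seeds : zero ∈ seeds
      few-seeds  : n * ∣ seeds ∣ < ∣ burnedAfter p H time seeds ∣ + n

  burned : Stage → Subset (order H)
  burned s = burnedAfter p H (Stage.time s) (Stage.seeds s)

  ignite-edge : ∀ (s : Stage) {e w A} → e ∈ₗ edges H → w ∈ e → w ∉ burned s →
    A ⊆ e ─ burned s → n * ∣ A ∣ ≤ ∣ e ─ burned s ∣ →
    threshold p ∣ e ∣ ℤ.≤ + (∣ burned s ∩ e ∣ + ∣ A ∣) →
    ∃[ s′ ] ∣ burned s ∣ < ∣ burned s′ ∣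
  ignite-edge record { seeds = S ; time = t ; zero∈seeds = 0∈S ; few-seeds = few } {e} {w} {A}
            e∈E w∈e w∉C A⊆e─C n*∣A∣≤∣e─C∣ th≤ = s′ , C<C′
    where
    C C′ : Subset (order H)
    C = burnedAfter p H t S
    C′ = burnedAfter p H (suc t) (S ∪ A)
    C+e─C≤C′ : ∣ C ∣ + ∣ e ─ C ∣ ≤ ∣ C′ ∣
    C+e─C≤C′ = subst (_≤ ∣ C′ ∣) (∣p∪q∣≡∣p∣+∣q─p∣ C e)
                 (p⊆q⇒∣p∣≤∣q∣ (seeding-burns-edge p H t S e∈E A⊆e─C th≤))
    C<C′ : ∣ C ∣ < ∣ C′ ∣
    C<C′ = <-≤-trans (m<m+n ∣ C ∣ (x∈p⇒0<∣p∣ (x∈p∧x∉q⇒x∈p─q w∈e w∉C))) C+e─C≤C′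
    few′ : n * ∣ S ∪ A ∣ < ∣ C′ ∣ + n
    few′ = begin-strict
      n * ∣ S ∪ A ∣     ≤⟨ *-monoʳ-≤ n (∣p∪q∣≤∣p∣+∣q∣ S A) ⟩
      n * (σ + a)       ≡⟨ *-distribˡ-+ n σ a ⟩
      n * σ + n * a     <⟨ +-monoˡ-< (n * a) few ⟩
      c + n + n * a     ≤⟨ +-monoʳ-≤ (c + n) n*∣A∣≤∣e─C∣ ⟩
      c + n + d         ≡⟨ +-assoc c n d ⟩
      c + (n + d)       ≡⟨ cong (λ x → c + x) (+-comm n d) ⟩
      c + (d + n)       ≡⟨ +-assoc c d n ⟨
      c + d + n         ≤⟨ +-monoˡ-≤ n C+e─C≤C′ ⟩
      ∣ C′ ∣ + n        ∎
      where
      open ≤-Reasoning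
      σ a c d : ℕ
      σ = ∣ S ∣
      a = ∣ A ∣
      c = ∣ C ∣
      d = ∣ e ─ C ∣
    s′ : Stage
    s′ = record { seeds = S ∪ A ; time = suc t ; zero∈seeds = p⊆p∪q A 0∈S ; few-seeds = few′ }

  extend : (s : Stage) → ∃[ y ] y ∉ burned s → ∃[ s′ ] ∣ burned s ∣ < ∣ burned s′ ∣
  extend s (y , y∉C) =
    let u , w , (e , e∈E , u∈e , w∈e) , u∈C , w∉C =
          star-crossing (_∈? burned s) (connected zero y)
            (⊆-burnedAfter p H (Stage.time s) (Stage.seeds s) (Stage.zero∈seeds s)) y∉C
        t , th≤t , t*n<∣e∣+n = threshold≤ ∣ e ∣
        A , A⊆e─C , n*∣A∣≤∣e─C∣ , t≤c+∣A∣ =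
          igniting-seeds n t (burned s) e (x∈p⇒0<∣p∣ (x∈p∩q⁺ (u∈C , u∈e))) t*n<∣e∣+n
    in ignite-edge s e∈E w∈e w∉C A⊆e─C n*∣A∣≤∣e─C∣ (ℤ.≤-trans th≤t (ℤ.+≤+ t≤c+∣A∣))

  LazyBurningSet≤⌈/n⌉ : Set
  LazyBurningSet≤⌈/n⌉ = Σ[ S ∈ Subset (order H) ] IsLazyBurningSet p H S × n * ∣ S ∣ < order H + n

  run : ∀ fuel (s : Stage) → order H ≤ ∣ burned s ∣ + fuel → LazyBurningSet≤⌈/n⌉
  run fuel s enough with p≡⊤⊎∃∉ (burned s)
  run fuel s enough | inj₁ all-burned =
    Stage.seeds s , (Stage.time s , all-burned) ,
    subst (λ m → n * ∣ Stage.seeds s ∣ < m + n) (trans (cong ∣_∣ all-burned) (∣⊤∣≡n _))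
      (Stage.few-seeds s)
  run zero s enough | inj₂ (_ , y∉C) =
    contradiction (subst (order H ≤_) (+-identityʳ _) enough) (<⇒≱ (x∉p⇒∣p∣<n y∉C))
  run (suc fuel) s enough | inj₂ missing =
    let s′ , C<C′ = extend s missing in
    run fuel s′ (≤-trans enough (≤-trans (≤-reflexive (+-suc _ fuel)) (+-monoˡ-≤ fuel C<C′)))

  initial : Stage
  initial = record
    { seeds = ⁅ zero ⁆ ; time = 0 ; zero∈seeds = x∈⁅x⁆ zero
    ; few-seeds = subst (λ k → n * k < k + n) (sym (∣⁅x⁆∣≡1 (zero {k H})))
                    (subst (_< suc n) (sym (*-identityʳ n)) (n<1+n n)) }

  lazyBurningSet : LazyBurningSet≤⌈/n⌉
  lazyBurningSet = run (order H) initial (m≤n+m (order H) ∣ burned initial ∣)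

theorem2p22 : (H : Hypergraph) → Connected H →
    (n : ℕ) .{{_ : NonZero n}} → 2 ≤ n →
    LazyBurningNumber≤ (+ 1 / n) H ⌈ + order H / n ⌉
theorem2p22 H connected n _ =
  let S , lazy , n*∣S∣<N+n = LazyBurning.lazyBurningSet (+ 1 / n) H connected n threshold≤⌈m/n⌉
      t , ⌈N/n⌉≡t , N≤t*n , _ = ceiling-/ (order H) n
  in S , lazy ,
     subst (+ ∣ S ∣ ℤ.≤_) (sym ⌈N/n⌉≡t) (ℤ.+≤+ (n*s<m+n⇒s≤t n ∣ S ∣ (order H) t n*∣S∣<N+n N≤t*n))
  where
  threshold≤⌈m/n⌉ : ∀ m → ∃[ t ] threshold (+ 1 / n) m ℤ.≤ + t × t * n < m + n
  threshold≤⌈m/n⌉ m =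
    let t , ⌈m/n⌉≡t , _ , t*n<m+n = ceiling-/ m n
    in t , ℤ.≤-reflexive (trans (cong ceiling (1/n*m≡m/n m n)) ⌈m/n⌉≡t) , t*n<m+n
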